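{- Let $T=(S,I,R)$ be a transition system and let $\alpha_1$ and $\alpha_2$ be disjoint predicate abstraction functions. If $\alpha_1$ is imprecise with respect to transitions $r_1,r_2\in R$, then both $\alpha_1\circ\alpha_2$ and $\alpha_2\circ\alpha_1$ are imprecise with respect to $r_1,r_2$.
   Context: Systems are transition systems over boolean and unbounded integer variables; sets of states and transitions are represented by formulas, and $\sqsubseteq$ denotes logical implication ($\sqsubset$ strict implication). A predicate abstraction is determined by a set $\varphi=\{\varphi_1,\dots,\varphi_n\}$ of predicates over integer variables with fresh boolean variables $b_i$ standing for $\varphi_i$; $V(\varphi)$ is the set of variables occurring in $\varphi$. On states, $\alpha(s)=\exists V(\varphi).(s\wedge\bigwedge_i(\varphi_i\iff b_i))$ and $\gamma(s^\sharp)=s^\sharp[\bar\varphi/\bar b]$. On a transition $r$ (a formula over current and primed next-state variables), $\alpha(r)=\exists V(\varphi).\exists V(\varphi').\big(r\wedge CS\wedge\bigwedge_i(\varphi_i\iff b_i)\wedge\bigwedge_i(\varphi_i'\iff b_i')\big)$, where $\varphi_i'$ is $\varphi_i$ with variables primed and $CS=\bigwedge_i\big((\bigwedge_{v\in V(\varphi_i)}v'=v)\implies(b_i'\iff b_i)\big)$. Two predicate abstraction functions are disjoint if the variable sets of their predicate sets are disjoint. For a transition relation $r$ and set $A$, $Pre[r](A)=\{x\mid \exists y\in A.\,(x,y)\in r\}$; $Range(f)$ rewrites formula $f$ by renaming variables to their next-state (primed) versions. An abstraction $\alpha$ (with concretization $\gamma$) is imprecise with respect to transitions $r_1,r_2$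 if $r_2\wedge Range(Pre[r_1](true))\sqsubset\gamma\big(\alpha(r_2)\wedge Range(Pre[\alpha(r_1)](true))\big)$ or $r_1\wedge Range(Pre[r_2](true))\sqsubset\gamma\big(\alpha(r_1)\wedge Range(Pre[\alpha(r_2)](true))\big)$. -}

module Defs where

open import Level using (Level; _⊔_) renaming (suc to lsuc)
open import Data.Nat as ℕ using (ℕ; zero; suc)
open import Data.Integer as ℤ using (ℤ)
open import Data.Bool using (Bool; true; false; not; _∧_; _∨_)
open import Data.Fin using (Fin; zero; suc)
open import Data.List using (List; []; _∷_; _++_; concatMap; allFin)
open import Data.List.Membership.Propositional using (_∈_; _∉_)
open import Data.Maybe using (Maybe; just; nothing)
import Data.Maybe as Maybe
open import Data.Product using (Σ; ∃; _×_; _,_)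
open import Data.Sum using (_⊎_)
open import Data.Empty using (⊥)
open import Data.Unit using (⊤)
open import Relation.Nullary using (¬_; yes; no)
open import Relation.Nullary.Decidable using (⌊_⌋)
open import Relation.Binary.PropositionalEquality using (_≡_; _≢_)
open import Function using (_∘_)

data Term : Set where
  var   : ℕ → Term
  const : ℤ → Term
  _⊕_   : Term → Term → Term
  _⊗_   : Term → Term → Term
  ⊝_    : Term → Term

data Pred : Set where
  trueₚ  : Pred
  falseₚ : Pred
  _≤ₚ_   : Term → Term → Pred
  _≐ₚ_   : Term → Term → Pred
  ¬ₚ_    : Pred → Pred
  _∧ₚ_   : Pred → Pred → Pred
  _∨ₚ_   : Pred → Pred → Pred

evalT : (ℕ → ℤ) → Term → ℤ
evalT ρ (var x)   = ρ x
evalT ρ (const c) = c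
evalT ρ (s ⊕ t)   = evalT ρ s ℤ.+ evalT ρ t
evalT ρ (s ⊗ t)   = evalT ρ s ℤ.* evalT ρ t
evalT ρ (⊝ t)     = ℤ.- evalT ρ t

evalP : (ℕ → ℤ) → Pred → Bool
evalP ρ trueₚ    = true
evalP ρ falseₚ   = false
evalP ρ (s ≤ₚ t) = ⌊ evalT ρ s ℤ.≤? evalT ρ t ⌋
evalP ρ (s ≐ₚ t) = ⌊ evalT ρ s ℤ.≟ evalT ρ t ⌋
evalP ρ (¬ₚ p)   = not (evalP ρ p)
evalP ρ (p ∧ₚ q) = evalP ρ p ∧ evalP ρ q
evalP ρ (p ∨ₚ q) = evalP ρ p ∨ evalP ρ q

varsT : Term → List ℕ
varsT (var x)   = x ∷ []
varsT (const c) = []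
varsT (s ⊕ t)   = varsT s ++ varsT t
varsT (s ⊗ t)   = varsT s ++ varsT t
varsT (⊝ t)     = varsT t

varsP : Pred → List ℕ
varsP trueₚ    = []
varsP falseₚ   = []
varsP (s ≤ₚ t) = varsT s ++ varsT t
varsP (s ≐ₚ t) = varsT s ++ varsT t
varsP (¬ₚ p)   = varsP p
varsP (p ∧ₚ q) = varsP p ++ varsP q
varsP (p ∨ₚ q) = varsP p ++ varsP q

record State : Set where
  constructor ⟨_,_⟩
  field
    int  : ℕ → ℤ
    bool : ℕ → Bool

open State public

StateSet : Set₁
StateSet = State → Set

-- a transition formula: relation between current and next (primed) state
Trans : Set₁
Trans = State → State → Set

_⊑_ : Trans → Trans → Set
r ⊑ q = ∀ σ σ' → r σ σ' → q σ σ'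

_⊏_ : Trans → Trans → Set
r ⊏ q = (r ⊑ q) × ¬ (q ⊑ r)

_∧ᵗ_ : Trans → Trans → Trans
(r ∧ᵗ q) σ σ' = r σ σ' × q σ σ'

trueₛ : StateSet
trueₛ _ = ⊤

Pre : Trans → StateSet → StateSet
Pre r A x = Σ State λ y → A y × r x y

-- Range(f): f with all variables renamed to their primed versions
Range : StateSet → Trans
Range f σ σ' = f σ'

record TransitionSystem : Set₂ where
  field
    S : StateSet
    I : StateSet
    R : List Trans

record PredAbs : Set where
  field
    size : ℕ
    φ    : Fin size → Pred
    b    : Fin size → ℕ          -- the boolean variable b_i standing for φ_i
    b-distinct : ∀ i j → b i ≡ b j → i ≡ j

open PredAbs public

V : PredAbs → List ℕ
V A = concatMap (λ i → varsP (φ A i)) (allFin (size A))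

-- τ arises from σ by changing only integer variables in L (used for ∃L)
AgreeOutside : List ℕ → State → State → Set
AgreeOutside L σ τ = (∀ x → x ∉ L → int σ x ≡ int τ x) × (∀ x → bool σ x ≡ bool τ x)

Link : PredAbs → State → Set
Link A σ = ∀ i → evalP (int σ) (φ A i) ≡ bool σ (b A i)

CS : PredAbs → State → State → Set
CS A τ τ' = ∀ i → (∀ v → v ∈ varsP (φ A i) → int τ' v ≡ int τ v)
                → bool τ' (b A i) ≡ bool τ (b A i)

αT : PredAbs → Trans → Trans
αT A r σ σ' =
  Σ State λ τ → Σ State λ τ' →
    AgreeOutside (V A) σ τ × AgreeOutside (V A) σ' τ' ×
    r τ τ' × CS A τ τ' × Link A τ × Link A τ'

findB : (n : ℕ) → (Fin n → ℕ) → ℕ → Maybe (Fin n)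
findB zero    bv x = nothing
findB (suc n) bv x with bv zero ℕ.≟ x
... | yes _ = just zero
... | no  _ = Maybe.map suc (findB n (bv ∘ suc) x)

substB : PredAbs → State → State
substB A σ = ⟨ int σ , (λ x → valB (findB (size A) (b A) x) x) ⟩
  where
  valB : Maybe (Fin (size A)) → ℕ → Bool
  valB (just i) x = evalP (int σ) (φ A i)
  valB nothing  x = bool σ x

γT : PredAbs → Trans → Trans
γT A r σ σ' = r (substB A σ) (substB A σ')

record Abstraction : Set₁ where
  field
    abs  : Trans → Trans
    conc : Trans → Trans

open Abstraction public

⟦_⟧ : PredAbs → Abstraction
⟦ A ⟧ = record { abs = αT A ; conc = γT A }

_∘ₐ_ : Abstraction → Abstraction → Abstraction
a₁ ∘ₐ a₂ = record { abs = abs a₁ ∘ abs a₂ ; conc = conc a₂ ∘ conc a₁ }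

Imprecise : Abstraction → Trans → Trans → Set
Imprecise a r₁ r₂ =
  ((r₂ ∧ᵗ Range (Pre r₁ trueₛ)) ⊏ conc a (abs a r₂ ∧ᵗ Range (Pre (abs a r₁) trueₛ)))
  ⊎ ((r₁ ∧ᵗ Range (Pre r₂ trueₛ)) ⊏ conc a (abs a r₁ ∧ᵗ Range (Pre (abs a r₂) trueₛ)))

Disjoint : PredAbs → PredAbs → Set
Disjoint A₁ A₂ = ∀ x → x ∈ V A₁ → x ∈ V A₂ → ⊥

FreshApart : PredAbs → PredAbs → Set
FreshApart A₁ A₂ = ∀ i j → b A₁ i ≢ b A₂ j

setB : State → ℕ → Bool → State
setB σ x v = ⟨ int σ , (λ y → Data.Bool.if ⌊ y ℕ.≟ x ⌋ then v else bool σ y) ⟩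

-- r does not mention the boolean variable x (neither unprimed nor primed)
FreeOfB : ℕ → Trans → Set
FreeOfB x r = ∀ σ σ' v → (r σ σ' → r (setB σ x v) σ') × (r σ σ' → r σ (setB σ' x v))

FreshFor : PredAbs → TransitionSystem → Set₁
FreshFor A T = ∀ r → r ∈ TransitionSystem.R T → ∀ i → FreeOfB (b A i) r

module Submission where

-- Setting every boolean variable of α₂ to the value of its predicate turns an α₁-witness pair
-- (τ, τ') of a transition into a witness pair for either composite abstraction: the transition is
-- unaffected because the b-variables are fresh for it, and nothing α₁ observes changes because the
-- two predicate sets share no integer variables and their b-variables are distinct. Hence
-- γ₁(α₁ r₂ ∧ Range(Pre[α₁ r₁](true))) implies the corresponding formula for α₁ ∘ α₂ and for α₂ ∘ α₁,
-- and a strict implication followed by an implication is strict.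

open import Defs
open import Data.Bool using (Bool; not; _∧_; _∨_)
open import Data.Empty using (⊥-elim)
open import Data.Fin using (Fin; zero; suc)
open import Data.Fin.Properties using (0≢1+n; suc-injective; any?)
import Data.Integer as ℤ
open import Data.List using (List; _++_)
open import Data.List.Membership.Propositional using (_∈_; _∉_)
open import Data.List.Membership.Propositional.Properties using (∈-++⁺ˡ; ∈-++⁺ʳ; ∈-concat⁺′; ∈-map⁺; ∈-allFin)
open import Data.List.Relation.Unary.Any using (here)
open import Data.Maybe using (just; nothing)
import Data.Maybe as Maybe
open import Data.Nat as ℕ using (ℕ; zero; suc)
open import Data.Product using (_×_; _,_; proj₁; proj₂)
open import Data.Sum using (inj₁; inj₂)
open import Data.Unit using (tt)
open import Function using (_∘_)
open import Relation.Nullary using (yes; no)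
open import Relation.Nullary.Decidable using (⌊_⌋)
open import Relation.Binary.PropositionalEquality

⊏-⊑-trans : ∀ {r q p : Trans} → r ⊏ q → q ⊑ p → r ⊏ p
⊏-⊑-trans (r⊑q , q⋢r) q⊑p = (λ σ σ' → q⊑p σ σ' ∘ r⊑q σ σ') , (λ p⊑r → q⋢r (λ σ σ' → p⊑r σ σ' ∘ q⊑p σ σ'))

AbstractedAfter : Abstraction → Trans → Trans → Trans
AbstractedAfter a r q = conc a (abs a q ∧ᵗ Range (Pre (abs a r) trueₛ))

Imprecise-mono : ∀ a c {r₁ r₂}
  → AbstractedAfter a r₁ r₂ ⊑ AbstractedAfter c r₁ r₂
  → AbstractedAfter a r₂ r₁ ⊑ AbstractedAfter c r₂ r₁
  → Imprecise a r₁ r₂ → Imprecise c r₁ r₂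
Imprecise-mono a c ⊑₁₂ _ (inj₁ p) = inj₁ (⊏-⊑-trans p ⊑₁₂)
Imprecise-mono a c _ ⊑₂₁ (inj₂ p) = inj₂ (⊏-⊑-trans p ⊑₂₁)

AgreeOn : List ℕ → (ℕ → ℤ.ℤ) → (ℕ → ℤ.ℤ) → Set
AgreeOn L ρ ρ' = ∀ v → v ∈ L → ρ v ≡ ρ' v

module _ {ρ ρ' : ℕ → ℤ.ℤ} where

  AgreeOn-++ˡ : ∀ xs {ys} → AgreeOn (xs ++ ys) ρ ρ' → AgreeOn xs ρ ρ'
  AgreeOn-++ˡ _ h v = h v ∘ ∈-++⁺ˡ

  AgreeOn-++ʳ : ∀ xs {ys} → AgreeOn (xs ++ ys) ρ ρ' → AgreeOn ys ρ ρ'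
  AgreeOn-++ʳ xs h v = h v ∘ ∈-++⁺ʳ xs

  evalT-cong : ∀ t → AgreeOn (varsT t) ρ ρ' → evalT ρ t ≡ evalT ρ' t
  evalT-cong (var x)   h = h x (here refl)
  evalT-cong (const c) h = refl
  evalT-cong (s ⊕ t)   h = cong₂ ℤ._+_ (evalT-cong s (AgreeOn-++ˡ (varsT s) h)) (evalT-cong t (AgreeOn-++ʳ (varsT s) h))
  evalT-cong (s ⊗ t)   h = cong₂ ℤ._*_ (evalT-cong s (AgreeOn-++ˡ (varsT s) h)) (evalT-cong t (AgreeOn-++ʳ (varsT s) h))
  evalT-cong (⊝ t)     h = cong ℤ.-_ (evalT-cong t h)

  evalP-cong : ∀ p → AgreeOn (varsP p) ρ ρ' → evalP ρ p ≡ evalP ρ' p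
  evalP-cong trueₚ    h = refl
  evalP-cong falseₚ   h = refl
  evalP-cong (s ≤ₚ t) h = cong₂ (λ m n → ⌊ m ℤ.≤? n ⌋)
    (evalT-cong s (AgreeOn-++ˡ (varsT s) h)) (evalT-cong t (AgreeOn-++ʳ (varsT s) h))
  evalP-cong (s ≐ₚ t) h = cong₂ (λ m n → ⌊ m ℤ.≟ n ⌋)
    (evalT-cong s (AgreeOn-++ˡ (varsT s) h)) (evalT-cong t (AgreeOn-++ʳ (varsT s) h))
  evalP-cong (¬ₚ p)   h = cong not (evalP-cong p h)
  evalP-cong (p ∧ₚ q) h = cong₂ _∧_ (evalP-cong p (AgreeOn-++ˡ (varsP p) h)) (evalP-cong q (AgreeOn-++ʳ (varsP p) h))
  evalP-cong (p ∨ₚ q) h = cong₂ _∨_ (evalP-cong p (AgreeOn-++ˡ (varsP p) h)) (evalP-cong q (AgreeOn-++ʳ (varsP p) h))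

varsP⊆V : ∀ A i {x} → x ∈ varsP (φ A i) → x ∈ V A
varsP⊆V A i x∈ = ∈-concat⁺′ x∈ (∈-map⁺ (λ j → varsP (φ A j)) (∈-allFin i))

Link⇒CS : ∀ A {τ τ'} → Link A τ → Link A τ' → CS A τ τ'
Link⇒CS A l l' i h = trans (sym (l' i)) (trans (evalP-cong (φ A i) h) (l i))

findB-at : ∀ n (bv : Fin n → ℕ) → (∀ i j → bv i ≡ bv j → i ≡ j) → ∀ i → findB n bv (bv i) ≡ just i
findB-at (suc n) bv inj i with bv zero ℕ.≟ bv i
... | yes e = cong just (inj zero i e)
findB-at (suc n) bv inj zero    | no ne = ⊥-elim (ne refl)
findB-at (suc n) bv inj (suc i) | no _
  rewrite findB-at n (bv ∘ suc) (λ i j → suc-injective ∘ inj (suc i) (suc j)) i = refl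

findB-absent : ∀ n (bv : Fin n → ℕ) {x} → (∀ i → bv i ≢ x) → findB n bv x ≡ nothing
findB-absent zero    bv     h = refl
findB-absent (suc n) bv {x} h with bv zero ℕ.≟ x
... | yes e = ⊥-elim (h zero e)
... | no _  = cong (Maybe.map suc) (findB-absent n (bv ∘ suc) (h ∘ suc))

substB-Link : ∀ A σ → Link A (substB A σ)
substB-Link A σ i rewrite findB-at (size A) (b A) (b-distinct A) i = refl

substB-other : ∀ A σ {x} → (∀ i → b A i ≢ x) → bool (substB A σ) x ≡ bool σ x
substB-other A σ h rewrite findB-absent (size A) (b A) h = refl

setB-same : ∀ σ x v → bool (setB σ x v) x ≡ v
setB-same σ x v with x ℕ.≟ x
... | yes _ = refl
... | no ne = ⊥-elim (ne refl)

setB-other : ∀ σ {x y} v → x ≢ y → bool (setB σ y v) x ≡ bool σ x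
setB-other σ {x} {y} v ne with x ℕ.≟ y
... | yes e = ⊥-elim (ne e)
... | no _  = refl

setBs : State → (n : ℕ) → (Fin n → ℕ) → (Fin n → Bool) → State
setBs σ zero    xs vs = σ
setBs σ (suc n) xs vs = setB (setBs σ n (xs ∘ suc) (vs ∘ suc)) (xs zero) (vs zero)

setBs-int : ∀ σ n xs vs → int (setBs σ n xs vs) ≡ int σ
setBs-int σ zero    xs vs = refl
setBs-int σ (suc n) xs vs = setBs-int σ n (xs ∘ suc) (vs ∘ suc)

setBs-at : ∀ σ n xs vs → (∀ i j → xs i ≡ xs j → i ≡ j) → ∀ i → bool (setBs σ n xs vs) (xs i) ≡ vs i
setBs-at σ (suc n) xs vs inj zero    = setB-same (setBs σ n (xs ∘ suc) (vs ∘ suc)) (xs zero) (vs zero)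
setBs-at σ (suc n) xs vs inj (suc i) =
  trans (setB-other (setBs σ n (xs ∘ suc) (vs ∘ suc)) (vs zero) (λ e → 0≢1+n (inj zero (suc i) (sym e))))
        (setBs-at σ n (xs ∘ suc) (vs ∘ suc) (λ i j → suc-injective ∘ inj (suc i) (suc j)) i)

setBs-other : ∀ σ n xs vs {x} → (∀ i → xs i ≢ x) → bool (setBs σ n xs vs) x ≡ bool σ x
setBs-other σ zero    xs vs h = refl
setBs-other σ (suc n) xs vs h =
  trans (setB-other (setBs σ n (xs ∘ suc) (vs ∘ suc)) (vs zero) (h zero ∘ sym)) (setBs-other σ n (xs ∘ suc) (vs ∘ suc) (h ∘ suc))

setBs-preservesˡ : ∀ {r : Trans} {σ σ'} n xs vs → (∀ i → FreeOfB (xs i) r) → r σ σ' → r (setBs σ n xs vs) σ'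
setBs-preservesˡ zero    xs vs fr rσσ' = rσσ'
setBs-preservesˡ (suc n) xs vs fr rσσ' =
  proj₁ (fr zero _ _ (vs zero)) (setBs-preservesˡ n (xs ∘ suc) (vs ∘ suc) (fr ∘ suc) rσσ')

setBs-preservesʳ : ∀ {r : Trans} {σ σ'} n xs vs → (∀ i → FreeOfB (xs i) r) → r σ σ' → r σ (setBs σ' n xs vs)
setBs-preservesʳ zero    xs vs fr rσσ' = rσσ'
setBs-preservesʳ (suc n) xs vs fr rσσ' =
  proj₂ (fr zero _ _ (vs zero)) (setBs-preservesʳ n (xs ∘ suc) (vs ∘ suc) (fr ∘ suc) rσσ')

FreeOfBs : PredAbs → Trans → Set
FreeOfBs A r = ∀ i → FreeOfB (b A i) r

-- Unlike substB A τ, which has the same valuation, this state is reached from τ by single updates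
-- setB, so transitions free of the b-variables are preserved (there is no function extensionality).
align : PredAbs → State → State
align A τ = setBs τ (size A) (b A) (λ i → evalP (int τ) (φ A i))

align-int : ∀ A τ → int (align A τ) ≡ int τ
align-int A τ = setBs-int τ (size A) (b A) _

align-Link : ∀ A τ → Link A (align A τ)
align-Link A τ i =
  trans (cong (λ ρ → evalP ρ (φ A i)) (align-int A τ)) (sym (setBs-at τ (size A) (b A) _ (b-distinct A) i))

align-other : ∀ A τ {x} → (∀ i → b A i ≢ x) → bool (align A τ) x ≡ bool τ x
align-other A τ = setBs-other τ (size A) (b A) _

align-preserves : ∀ A {r} {τ τ'} → FreeOfBs A r → r τ τ' → r (align A τ) (align A τ')
align-preserves A fr = setBs-preservesʳ (size A) (b A) _ fr ∘ setBs-preservesˡ (size A) (b A) _ fr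

module _ {A B : PredAbs} (apart : FreshApart A B) where

  align-b : ∀ τ i → bool (align B τ) (b A i) ≡ bool τ (b A i)
  align-b τ i = align-other B τ (λ j e → apart i j (sym e))

  Link-align : ∀ {τ} → Link A τ → Link A (align B τ)
  Link-align {τ} l i = trans (cong (λ ρ → evalP ρ (φ A i)) (align-int B τ)) (trans (l i) (sym (align-b τ i)))

  CS-align : ∀ {τ τ'} → CS A τ τ' → CS A (align B τ) (align B τ')
  CS-align {τ} {τ'} cs i h =
    trans (align-b τ' i)
      (trans (cs i (subst₂ (AgreeOn (varsP (φ A i))) (align-int B τ') (align-int B τ) h)) (sym (align-b τ i)))

Realises : PredAbs → Trans → State → State → Set
Realises A r τ τ' = r τ τ' × CS A τ τ' × Link A τ × Link A τ'

AgreeOutside-refl : ∀ L σ → AgreeOutside L σ σ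
AgreeOutside-refl L σ = (λ _ _ → refl) , (λ _ → refl)

Realises-align : ∀ A B {r τ τ'} → FreshApart A B → FreeOfBs B r
  → Realises A r τ τ' → Realises A r (align B τ) (align B τ')
Realises-align A B apart fr (rτ , cs , l , l') =
  align-preserves B fr rτ , CS-align {A} {B} apart cs , Link-align {A} {B} apart l , Link-align {A} {B} apart l'

Realises-align-self : ∀ B {r τ τ'} → FreeOfBs B r → r τ τ' → Realises B r (align B τ) (align B τ')
Realises-align-self B {τ = τ} {τ'} fr rτ =
  align-preserves B fr rτ , Link⇒CS B {align B τ} {align B τ'} (align-Link B τ) (align-Link B τ') , align-Link B τ , align-Link B τ'

module DisjointPair (A₁ A₂ : PredAbs) (disjoint : Disjoint A₁ A₂) (apart : FreshApart A₁ A₂) where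

  apart′ : FreshApart A₂ A₁
  apart′ j i e = apart i j (sym e)

  evalP₂-cong : ∀ {ρ ρ'} → (∀ x → x ∉ V A₁ → ρ x ≡ ρ' x) → ∀ j → evalP ρ (φ A₂ j) ≡ evalP ρ' (φ A₂ j)
  evalP₂-cong h j = evalP-cong (φ A₂ j) (λ v v∈ → h v (λ v∈V₁ → disjoint v v∈V₁ (varsP⊆V A₂ j v∈)))

  record FullySubstituted (σ Z : State) : Set where
    field
      int-eq : int Z ≡ int σ
      link₁  : Link A₁ Z
      link₂  : Link A₂ Z
      rest   : ∀ x → (∀ i → b A₁ i ≢ x) → (∀ j → b A₂ j ≢ x) → bool Z x ≡ bool σ x

  substituted₁₂ : ∀ σ → FullySubstituted σ (substB A₁ (substB A₂ σ))
  substituted₁₂ σ = record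
    { int-eq = refl
    ; link₁  = substB-Link A₁ _
    ; link₂  = λ j → trans (substB-Link A₂ σ j) (sym (substB-other A₁ _ (λ i → apart i j)))
    ; rest   = λ x n₁ n₂ → trans (substB-other A₁ _ n₁) (substB-other A₂ σ n₂)
    }

  substituted₂₁ : ∀ σ → FullySubstituted σ (substB A₂ (substB A₁ σ))
  substituted₂₁ σ = record
    { int-eq = refl
    ; link₁  = λ i → trans (substB-Link A₁ σ i) (sym (substB-other A₂ _ (λ j → apart′ j i)))
    ; link₂  = substB-Link A₂ _
    ; rest   = λ x n₁ n₂ → trans (substB-other A₂ _ n₂) (substB-other A₁ σ n₁)
    }

  Matches : State → State → Set
  Matches Z τ = AgreeOutside (V A₁) Z (align A₂ τ) × Link A₂ Z

  Matches-align : ∀ τ → Matches (align A₂ τ) τ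
  Matches-align τ = AgreeOutside-refl _ _ , align-Link A₂ τ

  Matches-substituted : ∀ {σ Z τ} → FullySubstituted σ Z → AgreeOutside (V A₁) (substB A₁ σ) τ → Matches Z τ
  Matches-substituted {σ} {Z} {τ} sub (ints , bools) = (ints′ , bools′) , link₂
    where
    open FullySubstituted sub

    ints′ : ∀ x → x ∉ V A₁ → int Z x ≡ int (align A₂ τ) x
    ints′ x x∉ = trans (cong-app int-eq x) (trans (ints x x∉) (sym (cong-app (align-int A₂ τ) x)))

    bools′ : ∀ x → bool Z x ≡ bool (align A₂ τ) x
    bools′ x with any? (λ j → b A₂ j ℕ.≟ x) | any? (λ i → b A₁ i ℕ.≟ x)
    ... | yes (j , refl) | _ = trans (sym (link₂ j)) (trans (evalP₂-cong ints′ j) (align-Link A₂ τ j))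
    ... | no ∉₂ | yes (i , refl) = begin
      bool Z (b A₁ i)                 ≡⟨ sym (link₁ i) ⟩
      evalP (int Z) (φ A₁ i)          ≡⟨ cong (λ ρ → evalP ρ (φ A₁ i)) int-eq ⟩
      evalP (int σ) (φ A₁ i)          ≡⟨ substB-Link A₁ σ i ⟩
      bool (substB A₁ σ) (b A₁ i)     ≡⟨ bools (b A₁ i) ⟩
      bool τ (b A₁ i)                 ≡⟨ sym (align-b {A₁} {A₂} apart τ i) ⟩
      bool (align A₂ τ) (b A₁ i)      ∎
      where open ≡-Reasoning
    ... | no ∉₂ | no ∉₁ = begin
      bool Z x                        ≡⟨ rest x (λ i e → ∉₁ (i , e)) (λ j e → ∉₂ (j , e)) ⟩
      bool σ x                        ≡⟨ sym (substB-other A₁ σ (λ i e → ∉₁ (i , e))) ⟩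
      bool (substB A₁ σ) x            ≡⟨ bools x ⟩
      bool τ x                        ≡⟨ sym (align-other A₂ τ (λ j e → ∉₂ (j , e))) ⟩
      bool (align A₂ τ) x             ∎
      where open ≡-Reasoning

  Transfers : Abstraction → Set₁
  Transfers c = ∀ {r Z Z' τ τ'} → FreeOfBs A₂ r
    → Matches Z τ → Matches Z' τ' → Realises A₁ r τ τ' → abs c r Z Z'

  transfers₁₂ : Transfers (⟦ A₁ ⟧ ∘ₐ ⟦ A₂ ⟧)
  transfers₁₂ {τ = τ} {τ'} fr (ag , _) (ag' , _) re@(rτ , _) =
      align A₂ τ , align A₂ τ' , ag , ag'
    , (align A₂ τ , align A₂ τ' , AgreeOutside-refl _ _ , AgreeOutside-refl _ _ , Realises-align-self A₂ fr rτ)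
    , proj₂ (Realises-align A₁ A₂ apart fr re)

  transfers₂₁ : Transfers (⟦ A₂ ⟧ ∘ₐ ⟦ A₁ ⟧)
  transfers₂₁ {Z = Z} {Z'} {τ} {τ'} fr (ag , l) (ag' , l') re =
      Z , Z' , AgreeOutside-refl _ _ , AgreeOutside-refl _ _
    , (align A₂ τ , align A₂ τ' , ag , ag' , Realises-align A₁ A₂ apart fr re)
    , Link⇒CS A₂ {Z} {Z'} l l' , l , l'

  -- δ is the substitution performed by conc c, so that conc c q σ σ' unfolds to q (δ σ) (δ σ').
  AbstractedAfter-⊑ : (c : Abstraction) (δ : State → State)
    → (∀ {q σ σ'} → q (δ σ) (δ σ') → conc c q σ σ')
    → (∀ σ → FullySubstituted σ (δ σ))
    → Transfers c
    → ∀ {r q} → FreeOfBs A₂ r → FreeOfBs A₂ q → AbstractedAfter ⟦ A₁ ⟧ r q ⊑ AbstractedAfter c r q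
  AbstractedAfter-⊑ c δ conc-δ sub transfers fr fq σ σ'
    ((τ , τ' , ag , ag' , re) , _ , _ , (υ , υ' , bg , _ , re′)) =
    conc-δ ( transfers fq (matches σ ag) (matches σ' ag') re
           , align A₂ υ' , tt , transfers fr (matches σ' bg) (Matches-align υ') re′)
    where
    matches : ∀ σ {τ} → AgreeOutside (V A₁) (substB A₁ σ) τ → Matches (δ σ) τ
    matches σ = Matches-substituted (sub σ)

  AbstractedAfter-⊑-∘₁₂ : ∀ {r q} → FreeOfBs A₂ r → FreeOfBs A₂ q
    → AbstractedAfter ⟦ A₁ ⟧ r q ⊑ AbstractedAfter (⟦ A₁ ⟧ ∘ₐ ⟦ A₂ ⟧) r q
  AbstractedAfter-⊑-∘₁₂ = AbstractedAfter-⊑ (⟦ A₁ ⟧ ∘ₐ ⟦ A₂ ⟧) (substB A₁ ∘ substB A₂) (λ q → q) substituted₁₂ transfers₁₂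

  AbstractedAfter-⊑-∘₂₁ : ∀ {r q} → FreeOfBs A₂ r → FreeOfBs A₂ q
    → AbstractedAfter ⟦ A₁ ⟧ r q ⊑ AbstractedAfter (⟦ A₂ ⟧ ∘ₐ ⟦ A₁ ⟧) r q
  AbstractedAfter-⊑-∘₂₁ = AbstractedAfter-⊑ (⟦ A₂ ⟧ ∘ₐ ⟦ A₁ ⟧) (substB A₂ ∘ substB A₁) (λ q → q) substituted₂₁ transfers₂₁

lemma2 : (T : TransitionSystem) (A₁ A₂ : PredAbs)
    → Disjoint A₁ A₂
    → FreshApart A₁ A₂ → FreshFor A₁ T → FreshFor A₂ T
    → (r₁ r₂ : Trans) → r₁ ∈ TransitionSystem.R T → r₂ ∈ TransitionSystem.R T
    → Imprecise ⟦ A₁ ⟧ r₁ r₂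
    → Imprecise (⟦ A₁ ⟧ ∘ₐ ⟦ A₂ ⟧) r₁ r₂ × Imprecise (⟦ A₂ ⟧ ∘ₐ ⟦ A₁ ⟧) r₁ r₂
lemma2 T A₁ A₂ disjoint apart _ fresh₂ r₁ r₂ r₁∈R r₂∈R imprecise =
    Imprecise-mono ⟦ A₁ ⟧ (⟦ A₁ ⟧ ∘ₐ ⟦ A₂ ⟧) (AbstractedAfter-⊑-∘₁₂ free₁ free₂) (AbstractedAfter-⊑-∘₁₂ free₂ free₁) imprecise
  , Imprecise-mono ⟦ A₁ ⟧ (⟦ A₂ ⟧ ∘ₐ ⟦ A₁ ⟧) (AbstractedAfter-⊑-∘₂₁ free₁ free₂) (AbstractedAfter-⊑-∘₂₁ free₂ free₁) imprecise
  where
  open DisjointPair A₁ A₂ disjoint apart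

  free₁ : FreeOfBs A₂ r₁
  free₁ = fresh₂ r₁ r₁∈R

  free₂ : FreeOfBs A₂ r₂
  free₂ = fresh₂ r₂ r₂∈R
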